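{- Let $r \geq 1$ be an integer and $n = \frac{1}{2}(r^2 + 3r - 2)$. Then $\operatorname{diam}(\mathcal{R}_n) \geq n - \left\lfloor \frac{r-1}{2} \right\rfloor$.
   Context: A binary string is called run-constrained if every run (maximal block) of consecutive $1$s in it is immediately followed by a run of $0$s of strictly greater length. For $n \geq 1$, the Fibonacci-run graph $\mathcal{R}_n$ has vertex set $\{ w \in \{0,1\}^n : w00 \text{ is a run-constrained string of length } n+2\}$, and two vertices are adjacent iff they differ in exactly one coordinate. $\operatorname{diam}(G)$ is the maximum graph distance between two vertices of $G$. -}

module Defs where

open import Data.Bool using (Bool; true; false; _∧_)
open import Data.Bool.Properties using () renaming (_≟_ to _≟B_)
open import Data.Nat using (ℕ; zero; suc; _<_)
open import Data.Product using (Σ; _×_; ∃; _,_; proj₁)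
open import Data.Unit using (⊤)
open import Data.Empty using (⊥)
open import Data.List using (List; []; _∷_; _++_)
open import Data.Vec using (Vec; toList; lookup)
open import Data.Fin using (Fin)
open import Relation.Nullary using (¬_; yes; no)
open import Relation.Binary.PropositionalEquality using (_≡_; _≢_)

-- Run-length encoding: list of maximal runs (symbol , length ≥ 1), left to right.
push : Bool → List (Bool × ℕ) → List (Bool × ℕ)
push b [] = (b , 1) ∷ []
push b ((c , k) ∷ rs) with b ≟B c
... | yes _ = (c , suc k) ∷ rs
... | no  _ = (b , 1) ∷ (c , k) ∷ rs

runs : List Bool → List (Bool × ℕ)
runs [] = []
runs (b ∷ xs) = push b (runs xs)

RunsOK : List (Bool × ℕ) → Set
RunsOK [] = ⊤
RunsOK ((false , _) ∷ rs) = RunsOK rs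
RunsOK ((true , a) ∷ []) = ⊥
RunsOK ((true , a) ∷ (c , b) ∷ rs) = (c ≡ false) × (a < b) × RunsOK ((c , b) ∷ rs)

RunConstrained : List Bool → Set
RunConstrained xs = RunsOK (runs xs)

IsVertex : (n : ℕ) → Vec Bool n → Set
IsVertex n w = RunConstrained (toList w ++ (false ∷ false ∷ []))

Vertex : ℕ → Set
Vertex n = Σ (Vec Bool n) (IsVertex n)

Adjacent : {n : ℕ} → Vec Bool n → Vec Bool n → Set
Adjacent {n} u v = Σ (Fin n) λ i → (lookup u i ≢ lookup v i) × (∀ j → j ≢ i → lookup u j ≡ lookup v j)

data Walk {n : ℕ} : Vertex n → Vertex n → ℕ → Set where
  here : ∀ {u} → Walk u u 0
  step : ∀ {u v w k} → Adjacent (proj₁ u) (proj₁ v) → Walk v w k → Walk u w (suc k)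

DiamAtLeast : ℕ → ℕ → Set
DiamAtLeast n m = Σ (Vertex n) λ u → Σ (Vertex n) λ v → ∀ k → Walk u v k → m Data.Nat.≤ k

-- A step of a walk flips one coordinate, so graph distance is at least Hamming
-- distance.  For r = k + 1 let S be the word with alternating runs of lengths
-- 1, 2, …, r ending in a run of ones, P = S 0^⌈k/2⌉ and a = ⌊k/2⌋.  Then P 0ᵃ
-- and (not P) 0ᵃ are vertices: runs of S and of (not S) strictly increase, the
-- run 1^r of S is followed by r + 1 zeros, and the run 1^⌈k/2⌉ of (not P) by
-- a + 2 zeros.  They differ in |P| = r(r+1)/2 + ⌈k/2⌉ = n − a coordinates.

module Submission where

open import Defs
open import Data.Bool using (Bool; true; false; not)
open import Data.Fin using (zero; suc)
import Data.Fin.Properties as Fin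
open import Data.List using (List; []; _∷_; _++_; length; map; replicate)
open import Data.List.Properties using (++-assoc; length-++; length-map; length-replicate; map-++; map-replicate)
open import Data.Nat using (ℕ; zero; suc; _+_; _*_; _∸_; _/_; _%_; _≤_; _<_; z≤n; s≤s; s≤s⁻¹)
open import Data.Nat.DivMod using (m≡m%n+[m/n]*n; m%n<n; m/n≤m)
open import Data.Nat.Properties
open import Data.Nat.Tactic.RingSolver using (solve-∀)
open import Data.Product using (Σ-syntax; _×_; _,_; proj₁)
open import Data.Unit using (tt)
open import Data.Vec using (Vec; []; _∷_; toList; lookup; fromList; cast; tabulate)
open import Data.Vec.Properties using (toList-cast; toList∘fromList; tabulate∘lookup; tabulate-cong)
open import Relation.Binary.PropositionalEquality using (_≡_; refl; sym; trans; cong; cong₂; subst; module ≡-Reasoning)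

differ : Bool → Bool → ℕ
differ true  true  = 0
differ false false = 0
differ _     _     = 1

hamming : List Bool → List Bool → ℕ
hamming (x ∷ xs) (y ∷ ys) = differ x y + hamming xs ys
hamming _        _        = 0

differ-self : ∀ x → differ x x ≡ 0
differ-self true  = refl
differ-self false = refl

differ≤1 : ∀ x y → differ x y ≤ 1
differ≤1 true  true  = z≤n
differ≤1 true  false = ≤-refl
differ≤1 false true  = ≤-refl
differ≤1 false false = z≤n

differ-triangle : ∀ x y z → differ x z ≤ differ x y + differ y z
differ-triangle true  true  z     = ≤-refl
differ-triangle false false z     = ≤-refl
differ-triangle true  false true  = z≤n
differ-triangle true  false false = ≤-refl
differ-triangle false true  true  = ≤-refl
differ-triangle false true  false = z≤n

hamming-self : ∀ xs → hamming xs xs ≡ 0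
hamming-self []       = refl
hamming-self (x ∷ xs) = cong₂ _+_ (differ-self x) (hamming-self xs)

hamming-not : ∀ xs → hamming xs (map not xs) ≡ length xs
hamming-not []           = refl
hamming-not (true  ∷ xs) = cong suc (hamming-not xs)
hamming-not (false ∷ xs) = cong suc (hamming-not xs)

hamming-++ : ∀ xs ys {xs′ ys′} → length xs ≡ length ys →
             hamming (xs ++ xs′) (ys ++ ys′) ≡ hamming xs ys + hamming xs′ ys′
hamming-++ []       []       _  = refl
hamming-++ (x ∷ xs) (y ∷ ys) eq =
  trans (cong (differ x y +_) (hamming-++ xs ys (suc-injective eq))) (sym (+-assoc (differ x y) _ _))

hamming-complement : ∀ xs zs → hamming (xs ++ zs) (map not xs ++ zs) ≡ length xs
hamming-complement xs zs = begin
  hamming (xs ++ zs) (map not xs ++ zs)       ≡⟨ hamming-++ xs (map not xs) (sym (length-map not xs)) ⟩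
  hamming xs (map not xs) + hamming zs zs     ≡⟨ cong₂ _+_ (hamming-not xs) (hamming-self zs) ⟩
  length xs + 0                               ≡⟨ +-identityʳ (length xs) ⟩
  length xs                                   ∎
  where open ≡-Reasoning

hamming-triangle : ∀ {n} (u v w : Vec Bool n) →
                   hamming (toList u) (toList w) ≤ hamming (toList u) (toList v) + hamming (toList v) (toList w)
hamming-triangle [] [] [] = z≤n
hamming-triangle (x ∷ u) (y ∷ v) (z ∷ w) = begin
  differ x z + hamming (toList u) (toList w)
    ≤⟨ +-mono-≤ (differ-triangle x y z) (hamming-triangle u v w) ⟩
  (differ x y + differ y z) + (hamming (toList u) (toList v) + hamming (toList v) (toList w))
    ≡⟨ +-comm-middle (differ x y) (differ y z) _ _ ⟩
  (differ x y + hamming (toList u) (toList v)) + (differ y z + hamming (toList v) (toList w)) ∎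
  where
  open ≤-Reasoning
  +-comm-middle : ∀ a b c d → (a + b) + (c + d) ≡ (a + c) + (b + d)
  +-comm-middle = solve-∀

vec-ext : ∀ {n} {u v : Vec Bool n} → (∀ i → lookup u i ≡ lookup v i) → u ≡ v
vec-ext {u = u} {v} agree = begin
  u                   ≡⟨ sym (tabulate∘lookup u) ⟩
  tabulate (lookup u) ≡⟨ tabulate-cong agree ⟩
  tabulate (lookup v) ≡⟨ tabulate∘lookup v ⟩
  v                   ∎
  where open ≡-Reasoning

Adjacent⇒hamming≤1 : ∀ {n} (u v : Vec Bool n) → Adjacent u v → hamming (toList u) (toList v) ≤ 1
Adjacent⇒hamming≤1 (x ∷ u) (y ∷ v) (zero , _ , agree)
  rewrite vec-ext {u = u} {v} (λ j → agree (suc j) λ ())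
        | hamming-self (toList v) | +-identityʳ (differ x y) = differ≤1 x y
Adjacent⇒hamming≤1 (x ∷ u) (y ∷ v) (suc i , differs , agree)
  rewrite agree zero (λ ()) | differ-self y =
  Adjacent⇒hamming≤1 u v (i , differs , λ j j≢i → agree (suc j) (λ eq → j≢i (Fin.suc-injective eq)))

hamming≤walk-length : ∀ {n} {u v : Vertex n} {k} → Walk u v k → hamming (toList (proj₁ u)) (toList (proj₁ v)) ≤ k
hamming≤walk-length {u = u} here rewrite hamming-self (toList (proj₁ u)) = z≤n
hamming≤walk-length {u = u} {w} (step {v = v} adj walk) = ≤-trans
  (hamming-triangle (proj₁ u) (proj₁ v) (proj₁ w))
  (+-mono-≤ (Adjacent⇒hamming≤1 (proj₁ u) (proj₁ v) adj) (hamming≤walk-length walk))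

words⇒DiamAtLeast : ∀ {n} xs ys →
  RunConstrained (xs ++ false ∷ false ∷ []) → RunConstrained (ys ++ false ∷ false ∷ []) →
  length xs ≡ n → length ys ≡ n → DiamAtLeast n (hamming xs ys)
words⇒DiamAtLeast {n} xs ys xs-ok ys-ok |xs|≡n |ys|≡n = vertex xs xs-ok |xs|≡n , vertex ys ys-ok |ys|≡n , far
  where
  word : ∀ zs → length zs ≡ n → Vec Bool n
  word zs eq = cast eq (fromList zs)
  toList-word : ∀ zs eq → toList (word zs eq) ≡ zs
  toList-word zs eq = trans (toList-cast eq (fromList zs)) (toList∘fromList zs)
  vertex : ∀ zs → RunConstrained (zs ++ false ∷ false ∷ []) → length zs ≡ n → Vertex n
  vertex zs ok eq = word zs eq , subst (λ w → RunConstrained (w ++ false ∷ false ∷ [])) (sym (toList-word zs eq)) ok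
  far : ∀ k → Walk (vertex xs xs-ok |xs|≡n) (vertex ys ys-ok |ys|≡n) k → hamming xs ys ≤ k
  far k walk = subst (_≤ k) (cong₂ hamming (toList-word xs |xs|≡n) (toList-word ys |ys|≡n)) (hamming≤walk-length walk)

complements⇒DiamAtLeast : ∀ {n} xs zs →
  RunConstrained (xs ++ zs ++ false ∷ false ∷ []) → RunConstrained (map not xs ++ zs ++ false ∷ false ∷ []) →
  length xs + length zs ≡ n → DiamAtLeast n (length xs)
complements⇒DiamAtLeast xs zs ok ok-not len = subst (DiamAtLeast _) (hamming-complement xs zs)
  (words⇒DiamAtLeast (xs ++ zs) (map not xs ++ zs)
    (subst RunConstrained (sym (++-assoc xs zs _)) ok)
    (subst RunConstrained (sym (++-assoc (map not xs) zs _)) ok-not)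
    (trans (length-++ xs) len)
    (trans (length-++ (map not xs)) (trans (cong (_+ length zs) (length-map not xs)) len)))

-- Invariant of the staircase induction: 1ᵏ ++ s stays run-constrained for all k < j.
LeadingZeros : ℕ → List Bool → Set
LeadingZeros j s = Σ[ m ∈ ℕ ] Σ[ rs ∈ List (Bool × ℕ) ] (runs s ≡ (false , m) ∷ rs) × (j ≤ m) × RunsOK rs

LeadingZeros⇒RunConstrained : ∀ {j} s → LeadingZeros j s → RunConstrained s
LeadingZeros⇒RunConstrained s (_ , _ , eq , _ , ok) rewrite eq = ok

false∷-LeadingZeros : ∀ s → RunConstrained s → LeadingZeros 1 (false ∷ s)
false∷-LeadingZeros s ok with runs s
... | []               = 1 , [] , refl , ≤-refl , tt
... | (false , m) ∷ rs = suc m , rs , refl , s≤s z≤n , ok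
... | (true , m) ∷ rs  = 1 , (true , m) ∷ rs , refl , ≤-refl , ok

false∷-LeadingZeros-suc : ∀ {j} s → LeadingZeros j s → LeadingZeros (suc j) (false ∷ s)
false∷-LeadingZeros-suc s (m , rs , eq , j≤m , ok) rewrite eq = suc m , rs , refl , s≤s j≤m , ok

replicate-false-++ : ∀ k {j} s → LeadingZeros j s → LeadingZeros (k + j) (replicate k false ++ s)
replicate-false-++ zero    s lz = lz
replicate-false-++ (suc k) s lz = false∷-LeadingZeros-suc (replicate k false ++ s) (replicate-false-++ k s lz)

replicate-suc-false-++ : ∀ k s → RunConstrained s → LeadingZeros (suc k) (replicate (suc k) false ++ s)
replicate-suc-false-++ zero    s ok = false∷-LeadingZeros s ok
replicate-suc-false-++ (suc k) s ok = false∷-LeadingZeros-suc (false ∷ replicate k false ++ s) (replicate-suc-false-++ k s ok)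

runs-replicate-true-++ : ∀ k s {m rs} → runs s ≡ (false , m) ∷ rs →
                         runs (replicate (suc k) true ++ s) ≡ (true , suc k) ∷ (false , m) ∷ rs
runs-replicate-true-++ zero    s eq rewrite eq = refl
runs-replicate-true-++ (suc k) s eq = cong (push true) (runs-replicate-true-++ k s eq)

replicate-true-++ : ∀ {j} k s → LeadingZeros j s → k < j → RunConstrained (replicate k true ++ s)
replicate-true-++ zero    s lz                       _   = LeadingZeros⇒RunConstrained s lz
replicate-true-++ (suc k) s (m , rs , eq , j≤m , ok) k<j =
  subst RunsOK (sym (runs-replicate-true-++ k s eq)) (refl , ≤-trans k<j j≤m , ok)

stair : Bool → ℕ → List Bool
stair b zero    = []
stair b (suc m) = stair (not b) m ++ replicate (suc m) b

stair-not : ∀ b m → stair (not b) m ≡ map not (stair b m)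
stair-not b zero    = refl
stair-not b (suc m) = begin
  stair (not (not b)) m ++ replicate (suc m) (not b)         ≡⟨ cong₂ _++_ (stair-not (not b) m) (sym (map-replicate not (suc m) b)) ⟩
  map not (stair (not b) m) ++ map not (replicate (suc m) b) ≡⟨ sym (map-++ not (stair (not b) m) _) ⟩
  map not (stair (not b) m ++ replicate (suc m) b)           ∎
  where open ≡-Reasoning

length-stair : ∀ b m → 2 * length (stair b m) ≡ m * suc m
length-stair b zero    = refl
length-stair b (suc m) = begin
  2 * length (stair (not b) m ++ replicate (suc m) b)            ≡⟨ cong (2 *_) (length-++ (stair (not b) m)) ⟩
  2 * (length (stair (not b) m) + length (replicate (suc m) b)) ≡⟨ cong (λ l → 2 * (length (stair (not b) m) + l)) (length-replicate (suc m)) ⟩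
  2 * (length (stair (not b) m) + suc m)                        ≡⟨ *-distribˡ-+ 2 (length (stair (not b) m)) (suc m) ⟩
  2 * length (stair (not b) m) + 2 * suc m                      ≡⟨ cong (_+ 2 * suc m) (length-stair (not b) m) ⟩
  m * suc m + 2 * suc m                                         ≡⟨ triangle-step m ⟩
  suc m * suc (suc m)                                           ∎
  where
  open ≡-Reasoning
  triangle-step : ∀ m → m * suc m + 2 * suc m ≡ suc m * suc (suc m)
  triangle-step = solve-∀

mutual
  stair-true-++ : ∀ m t → LeadingZeros (suc m) t → RunConstrained (stair true m ++ t)
  stair-true-++ zero    t lz = LeadingZeros⇒RunConstrained t lz
  stair-true-++ (suc m) t lz rewrite ++-assoc (stair false m) (replicate (suc m) true) t =
    stair-false-++ m (replicate (suc m) true ++ t) (replicate-true-++ (suc m) t lz ≤-refl)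

  stair-false-++ : ∀ m t → RunConstrained t → RunConstrained (stair false m ++ t)
  stair-false-++ zero    t ok = ok
  stair-false-++ (suc m) t ok rewrite ++-assoc (stair true m) (replicate (suc m) false) t =
    stair-true-++ m (replicate (suc m) false ++ t) (replicate-suc-false-++ m t ok)

m∸m/2+m/2≡m : ∀ m → m ∸ m / 2 + m / 2 ≡ m
m∸m/2+m/2≡m m = m∸n+n≡m (m/n≤m m 2)

m∸m/2≤1+m/2 : ∀ m → m ∸ m / 2 ≤ suc (m / 2)
m∸m/2≤1+m/2 m = +-cancelʳ-≤ (m / 2) (m ∸ m / 2) (suc (m / 2)) (begin
  m ∸ m / 2 + m / 2    ≡⟨ m∸m/2+m/2≡m m ⟩
  m                    ≡⟨ m≡m%n+[m/n]*n m 2 ⟩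
  m % 2 + m / 2 * 2    ≤⟨ +-monoˡ-≤ (m / 2 * 2) (s≤s⁻¹ (m%n<n m 2)) ⟩
  1 + m / 2 * 2        ≡⟨ double (m / 2) ⟩
  suc (m / 2) + m / 2  ∎)
  where
  open ≤-Reasoning
  double : ∀ a → 1 + a * 2 ≡ suc a + a
  double = solve-∀

-- P = S 0^⌈k/2⌉ with S = stair true r, indexed by k = r − 1.
staircase : ℕ → List Bool
staircase k = stair true (suc k) ++ replicate (k ∸ k / 2) false

length-staircase : ∀ k → length (staircase k) + k / 2 ≡ length (stair true (suc k)) + k
length-staircase k = begin
  length (staircase k) + k / 2            ≡⟨ cong (_+ k / 2) (length-++ S) ⟩
  S′ + length (replicate h false) + k / 2 ≡⟨ cong (λ x → S′ + x + k / 2) (length-replicate h) ⟩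
  S′ + h + k / 2                          ≡⟨ +-assoc S′ h (k / 2) ⟩
  S′ + (h + k / 2)                        ≡⟨ cong (S′ +_) (m∸m/2+m/2≡m k) ⟩
  S′ + k                                  ∎
  where
  open ≡-Reasoning
  S = stair true (suc k)
  S′ = length S
  h = k ∸ k / 2

zeros-then-00 : ∀ a → LeadingZeros (a + 2) (replicate a false ++ false ∷ false ∷ [])
zeros-then-00 a = replicate-false-++ a (false ∷ false ∷ []) (2 , [] , refl , ≤-refl , tt)

staircase-ok : ∀ k → RunConstrained (staircase k ++ replicate (k / 2) false ++ false ∷ false ∷ [])
staircase-ok k = subst RunConstrained (sym (++-assoc (stair true (suc k)) (replicate h false) tail))
  (stair-true-++ (suc k) (replicate h false ++ tail)
    (subst (λ j → LeadingZeros j (replicate h false ++ tail)) h+a+2≡2+k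
      (replicate-false-++ h tail (zeros-then-00 (k / 2)))))
  where
  h = k ∸ k / 2
  tail = replicate (k / 2) false ++ false ∷ false ∷ []
  h+a+2≡2+k : h + (k / 2 + 2) ≡ suc (suc k)
  h+a+2≡2+k = trans (sym (+-assoc h (k / 2) 2)) (trans (cong (_+ 2) (m∸m/2+m/2≡m k)) (+-comm k 2))

map-not-staircase : ∀ k → map not (staircase k) ≡ stair false (suc k) ++ replicate (k ∸ k / 2) true
map-not-staircase k = trans (map-++ not (stair true (suc k)) _)
  (cong₂ _++_ (sym (stair-not true (suc k))) (map-replicate not (k ∸ k / 2) false))

complement-ok : ∀ k → RunConstrained (map not (staircase k) ++ replicate (k / 2) false ++ false ∷ false ∷ [])
complement-ok k rewrite map-not-staircase k =
  subst RunConstrained (sym (++-assoc (stair false (suc k)) (replicate h true) tail))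
    (stair-false-++ (suc k) (replicate h true ++ tail) (replicate-true-++ h tail (zeros-then-00 (k / 2)) h<a+2))
  where
  h = k ∸ k / 2
  tail = replicate (k / 2) false ++ false ∷ false ∷ []
  h<a+2 : h < k / 2 + 2
  h<a+2 = subst (h <_) (+-comm 2 (k / 2)) (s≤s (m∸m/2≤1+m/2 k))

n≡|stair|+k : ∀ k n → 2 * n + 2 ≡ suc k * suc k + 3 * suc k → n ≡ length (stair true (suc k)) + k
n≡|stair|+k k n order = *-cancelˡ-≡ n (S + k) 2 (+-cancelʳ-≡ 2 (2 * n) (2 * (S + k)) (begin
  2 * n + 2                       ≡⟨ order ⟩
  suc k * suc k + 3 * suc k       ≡⟨ regroup k ⟩
  suc k * suc (suc k) + 2 * k + 2 ≡⟨ cong (λ x → x + 2 * k + 2) (sym (length-stair true (suc k))) ⟩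
  2 * S + 2 * k + 2               ≡⟨ cong (_+ 2) (sym (*-distribˡ-+ 2 S k)) ⟩
  2 * (S + k) + 2                 ∎))
  where
  open ≡-Reasoning
  S = length (stair true (suc k))
  regroup : ∀ k → suc k * suc k + 3 * suc k ≡ suc k * suc (suc k) + 2 * k + 2
  regroup = solve-∀

lemma5p1 : (r n : ℕ) → 1 ≤ r → 2 * n + 2 ≡ r * r + 3 * r →
    DiamAtLeast n (n ∸ ((r ∸ 1) / 2))
lemma5p1 zero    n () _
lemma5p1 (suc k) n _ order = subst (DiamAtLeast n) |staircase|≡n∸a
  (complements⇒DiamAtLeast (staircase k) (replicate a false) (staircase-ok k) (complement-ok k)
    (trans (cong (length (staircase k) +_) (length-replicate a)) |words|≡n))
  where
  a = k / 2
  |words|≡n : length (staircase k) + a ≡ n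
  |words|≡n = trans (length-staircase k) (sym (n≡|stair|+k k n order))
  |staircase|≡n∸a : length (staircase k) ≡ n ∸ a
  |staircase|≡n∸a = trans (sym (m+n∸n≡m (length (staircase k)) a)) (cong (_∸ a) |words|≡n)
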